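{- Let $\mathrm{Cay}(\mathbb{Z}_{n}, S)$ be a circulant graph such that $S_0$ is periodic with subgroup of periods $H$. Then $$\mathrm{Cay}(\mathbb{Z}_n, S) \cong \mathrm{Cay}(\pi_H(\mathbb{Z}_n), \pi_H(S)\setminus \{H\}) \otimes \mathrm{Cay}(H, H\setminus \{0\}).$$
   Context: $\mathrm{Cay}(\mathbb{Z}_n,S)$, for inverse-closed $S\subseteq\mathbb{Z}_n\setminus\{0\}$, has vertex set $\mathbb{Z}_n$ with $x\sim y$ iff $x-y\in S$; $S_0=S\cup\{0\}$. A nonzero $a$ with $S_0+a=S_0$ is a period; the periods together with $0$ form the subgroup of periods; $S_0$ is periodic if it is nontrivial. $\pi_H:\mathbb{Z}_n\to\mathbb{Z}_n/H$ is the canonical projection, applied elementwise to sets. The wreath product $\Gamma\otimes\Sigma$ has vertex set $V(\Gamma)\times V(\Sigma)$, with $(u,v)\sim(x,y)$ iff either $u\sim x$ in $\Gamma$, or $u=x$ and $v\sim y$ in $\Sigma$. -}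

module Defs where

open import Level using (0ℓ)
open import Data.Nat as ℕ using (ℕ; NonZero; _∸_)
open import Data.Nat.DivMod using (_mod_)
open import Data.Fin using (Fin; toℕ)
open import Data.Fin.Subset using (Subset; _∈_; _∉_; _∪_; ⁅_⁆)
open import Data.Product using (Σ; ∃; ∃-syntax; _×_; _,_; proj₁)
open import Data.Product.Relation.Binary.Pointwise.NonDependent using (×-setoid)
open import Data.Sum using (_⊎_)
open import Relation.Nullary using (¬_)
open import Relation.Unary using (Pred)
open import Relation.Binary using (Setoid)
open import Relation.Binary.PropositionalEquality
  using (_≡_; setoid; isEquivalence)
import Relation.Binary.Construct.On as On
open import Function.Bundles using (Inverse; _⇔_)
open import Function.Properties.Equivalence using ()
  renaming (refl to ⇔-refl; sym to ⇔-sym; trans to ⇔-trans)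

record Graph : Set₁ where
  field
    V   : Setoid 0ℓ 0ℓ
    _~_ : Setoid.Carrier V → Setoid.Carrier V → Set

open Graph public

record _≅_ (Γ Δ : Graph) : Set where
  field
    bij : Inverse (V Γ) (V Δ)
    adj : ∀ x y → (_~_ Γ x y) ⇔ (_~_ Δ (Inverse.to bij x) (Inverse.to bij y))

_⊗_ : Graph → Graph → Graph
Γ ⊗ Δ = record
  { V   = ×-setoid (V Γ) (V Δ)
  ; _~_ = λ { (u , v) (x , y) →
             _~_ Γ u x ⊎ (Setoid._≈_ (V Γ) u x × _~_ Δ v y) }
  }

module _ {n : ℕ} .{{_ : NonZero n}} where

  0ₙ : Fin n
  0ₙ = 0 mod n

  _+ₙ_ : Fin n → Fin n → Fin n
  x +ₙ y = (toℕ x ℕ.+ toℕ y) mod n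

  _-ₙ_ : Fin n → Fin n → Fin n
  x -ₙ y = (toℕ x ℕ.+ (n ∸ toℕ y)) mod n

  InverseClosed : Subset n → Set
  InverseClosed S = ∀ x → x ∈ S → (0ₙ -ₙ x) ∈ S

  S₀ : Subset n → Subset n
  S₀ S = S ∪ ⁅ 0ₙ ⁆

  _∈_+_ : Fin n → Subset n → Fin n → Set
  x ∈ T + a = ∃[ t ] (t ∈ T × x ≡ t +ₙ a)

  IsPeriod : Subset n → Fin n → Set
  IsPeriod S a = ¬ (a ≡ 0ₙ) × (∀ x → (x ∈ S₀ S + a) ⇔ (x ∈ S₀ S))

  Periodic : Subset n → Set
  Periodic S = ∃[ a ] IsPeriod S a

  Periods : Subset n → Pred (Fin n) 0ℓ
  Periods S a = a ≡ 0ₙ ⊎ IsPeriod S a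

  Cay : Subset n → Graph
  Cay S = record { V = setoid (Fin n) ; _~_ = λ x y → (x -ₙ y) ∈ S }

  -- The quotient ℤ_n / H for a subgroup H (given as a predicate):
  -- elements are represented by x ∈ ℤ_n, and π_H x = π_H y means the
  -- cosets x + H and y + H are equal as sets.
  _≈[_]_ : Fin n → Pred (Fin n) 0ℓ → Fin n → Set
  x ≈[ H ] y = ∀ z → H (z -ₙ x) ⇔ H (z -ₙ y)

  QuotSetoid : Pred (Fin n) 0ℓ → Setoid 0ℓ 0ℓ
  QuotSetoid H = record
    { Carrier = Fin n
    ; _≈_ = λ x y → x ≈[ H ] y
    ; isEquivalence = record
      { refl  = λ z → ⇔-refl
      ; sym   = λ e z → ⇔-sym (e z)
      ; trans = λ e f z → ⇔-trans (e z) (f z)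
      }
    }

  InQuotConn : Pred (Fin n) 0ℓ → Subset n → Fin n → Set
  InQuotConn H S c = (∃[ s ] (s ∈ S × c ≈[ H ] s)) × ¬ (c ≈[ H ] 0ₙ)

  QuotCay : Pred (Fin n) 0ℓ → Subset n → Graph
  QuotCay H S = record
    { V = QuotSetoid H
    ; _~_ = λ x y → InQuotConn H S (x -ₙ y) }

  SubCay : Pred (Fin n) 0ℓ → Graph
  SubCay H = record
    { V = record
      { Carrier = Σ (Fin n) H
      ; _≈_ = λ a b → proj₁ a ≡ proj₁ b
      ; isEquivalence = On.isEquivalence proj₁ isEquivalence }
    ; _~_ = λ a b → H (proj₁ a -ₙ proj₁ b) × ¬ (proj₁ a -ₙ proj₁ b ≡ 0ₙ) }

{-# OPTIONS --safe #-}
module Submission where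

-- The periods of S₀ together with 0 form its stabiliser H, a subgroup of
-- ℤₙ, so S₀ is a union of cosets of H.  Picking the least element repr x
-- of every coset, x ↦ (x + H , x − repr x) is a bijection ℤₙ → ℤₙ/H × H.
-- Under it a difference d = x − y lies in S iff either d ∉ H and the coset
-- d + H meets S, or d ∈ H ∖ {0} (then x + H = y + H and d is the difference
-- of the H-components): this is exactly adjacency in the wreath product.

open import Defs
open import Data.Nat using (ℕ; NonZero)
open import Data.Fin using (Fin)
open import Data.Fin.Subset using (Subset; _∉_)

open import Level using (0ℓ)
open import Function using (_∘_; id)
import Data.Nat.Properties as ℕ
open import Data.Nat.DivMod
  using (_mod_; m<n⇒m%n≡m; %-distribˡ-+; m%n%n≡m%n; [m+n]%n≡m%n)
open import Data.Fin as Fin using (toℕ; fromℕ<; _≤_)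
open import Data.Fin.Properties
  using ( toℕ-fromℕ<; toℕ-injective; toℕ<n; toℕ≤n; toℕ-inject; ≤-antisym
        ; ¬∀⟶∃¬-smallest; all?)
open import Data.Fin.Subset using (_∈_; ⁅_⁆)
open import Data.Fin.Subset.Properties
  using (_∈?_; x∈p∪q⁺; x∈p∪q⁻; x∈⁅x⁆; x∈⁅y⁆⇒x≡y)
open import Data.Product using (Σ; ∃; _×_; _,_; proj₁; proj₂; uncurry)
open import Data.Sum using (_⊎_; inj₁; inj₂; [_,_])
open import Data.Sum.Function.Propositional using (_⊎-⇔_)
open import Relation.Nullary using (¬_; Dec; yes; no; ¬?; contradiction)
open import Relation.Nullary.Decidable as Dec using (decidable-stable; _×-dec_; _→-dec_)
open import Relation.Unary using (Pred; Decidable)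
open import Relation.Binary using (Rel; Setoid; IsDecEquivalence)
open import Relation.Binary.PropositionalEquality
  using (_≡_; _≢_; refl; sym; trans; cong; cong₂; subst; module ≡-Reasoning)
open import Function.Bundles using (Inverse; _⇔_; mk⇔; Equivalence)
open import Function.Properties.Equivalence using (⇔-setoid)
  renaming (refl to ⇔-refl; sym to ⇔-sym; trans to ⇔-trans)

open Equivalence using (to; from)

-- Least elements and canonical representatives in Fin m

∃⟶∃-smallest : ∀ {m p} {P : Pred (Fin m) p} → Decidable P → ∃ P →
               ∃ λ i → P i × (∀ {j} → P j → i ≤ j)
∃⟶∃-smallest {m} {P = P} P? (x , px)
  with ¬∀⟶∃¬-smallest m (¬_ ∘ P) (¬? ∘ P?) (λ ∀¬P → ∀¬P x px)
... | i , ¬¬pi , ¬P-below-i = i , decidable-stable (P? i) ¬¬pi , i≤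
  where
  i≤ : ∀ {j} → P j → i ≤ j
  i≤ {j} pj = ℕ.≮⇒≥ λ j<i →
    ¬P-below-i (fromℕ< j<i)
      (subst P (toℕ-injective (sym (trans (toℕ-inject _) (toℕ-fromℕ< j<i)))) pj)

module CanonicalRepresentative
  {m ℓ} {_≈_ : Rel (Fin m) ℓ} (≈-isDecEquivalence : IsDecEquivalence _≈_) where

  private
    module ≈ = IsDecEquivalence ≈-isDecEquivalence

    least-in-class : ∀ x → ∃ λ i → i ≈ x × (∀ {j} → j ≈ x → i ≤ j)
    least-in-class x = ∃⟶∃-smallest (≈._≟ x) (x , ≈.refl)

  repr : Fin m → Fin m
  repr x = proj₁ (least-in-class x)

  repr-≈ : ∀ x → repr x ≈ x
  repr-≈ x = proj₁ (proj₂ (least-in-class x))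

  repr-cong : ∀ {x y} → x ≈ y → repr x ≡ repr y
  repr-cong {x} {y} x≈y = ≤-antisym
    (proj₂ (proj₂ (least-in-class x)) (≈.trans (repr-≈ y) (≈.sym x≈y)))
    (proj₂ (proj₂ (least-in-class y)) (≈.trans (repr-≈ x) x≈y))

_⇔-dec_ : ∀ {a b} {A : Set a} {B : Set b} → Dec A → Dec B → Dec (A ⇔ B)
a? ⇔-dec b? = Dec.map′ (uncurry mk⇔) (λ A⇔B → to A⇔B , from A⇔B)
                       ((a? →-dec b?) ×-dec (b? →-dec a?))

-- Arithmetic of ℤₙ

module _ {n : ℕ} .{{_ : NonZero n}} where

  -- Opened only here: in scope elsewhere, ℕ's _+_ makes Defs' x ∈ T + a ambiguous.
  open import Data.Nat using (_+_; _∸_; _%_; >-nonZero⁻¹)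

  toℕ-mod : ∀ a → toℕ (a mod n) ≡ a % n
  toℕ-mod a = toℕ-fromℕ< _

  mod-toℕ : ∀ x → toℕ x mod n ≡ x
  mod-toℕ x = toℕ-injective (trans (toℕ-mod _) (m<n⇒m%n≡m (toℕ<n x)))

  %≡⇒mod≡ : ∀ {a b} → a % n ≡ b % n → a mod n ≡ b mod n
  %≡⇒mod≡ {a} {b} eq = toℕ-injective (trans (toℕ-mod a) (trans eq (sym (toℕ-mod b))))

  toℕ-mod-+ˡ : ∀ a k → (toℕ (a mod n) + k) % n ≡ (a + k) % n
  toℕ-mod-+ˡ a k = begin
    (toℕ (a mod n) + k) % n  ≡⟨ cong (λ r → (r + k) % n) (toℕ-mod a) ⟩
    (a % n + k) % n          ≡⟨ %-distribˡ-+ (a % n) k n ⟩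
    (a % n % n + k % n) % n  ≡⟨ cong (λ r → (r + k % n) % n) (m%n%n≡m%n a n) ⟩
    (a % n + k % n) % n      ≡⟨ %-distribˡ-+ a k n ⟨
    (a + k) % n              ∎
    where open ≡-Reasoning

  toℕ-mod-+ʳ : ∀ k a → (k + toℕ (a mod n)) % n ≡ (k + a) % n
  toℕ-mod-+ʳ k a = begin
    (k + toℕ (a mod n)) % n  ≡⟨ cong (_% n) (ℕ.+-comm k _) ⟩
    (toℕ (a mod n) + k) % n  ≡⟨ toℕ-mod-+ˡ a k ⟩
    (a + k) % n              ≡⟨ cong (_% n) (ℕ.+-comm a k) ⟩
    (k + a) % n              ∎
    where open ≡-Reasoning

  toℕ-0ₙ : toℕ (0ₙ {n}) ≡ 0
  toℕ-0ₙ = trans (toℕ-mod 0) (m<n⇒m%n≡m (>-nonZero⁻¹ n))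

  +ₙ-comm : ∀ x y → x +ₙ y ≡ y +ₙ x
  +ₙ-comm x y = cong (_mod n) (ℕ.+-comm (toℕ x) (toℕ y))

  +ₙ-assoc : ∀ x y z → (x +ₙ y) +ₙ z ≡ x +ₙ (y +ₙ z)
  +ₙ-assoc x y z = %≡⇒mod≡ (begin
    (toℕ (x +ₙ y) + toℕ z) % n     ≡⟨ toℕ-mod-+ˡ _ (toℕ z) ⟩
    (toℕ x + toℕ y + toℕ z) % n    ≡⟨ cong (_% n) (ℕ.+-assoc (toℕ x) _ _) ⟩
    (toℕ x + (toℕ y + toℕ z)) % n  ≡⟨ toℕ-mod-+ʳ (toℕ x) _ ⟨
    (toℕ x + toℕ (y +ₙ z)) % n     ∎)
    where open ≡-Reasoning

  +ₙ-identityˡ : ∀ x → 0ₙ +ₙ x ≡ x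
  +ₙ-identityˡ x = trans (cong (λ k → (k + toℕ x) mod n) toℕ-0ₙ) (mod-toℕ x)

  +ₙ-identityʳ : ∀ x → x +ₙ 0ₙ ≡ x
  +ₙ-identityʳ x = trans (+ₙ-comm x 0ₙ) (+ₙ-identityˡ x)

  [x-y]+y≡x : ∀ x y → (x -ₙ y) +ₙ y ≡ x
  [x-y]+y≡x x y = trans (%≡⇒mod≡ (begin
    (toℕ (x -ₙ y) + toℕ y) % n         ≡⟨ toℕ-mod-+ˡ _ (toℕ y) ⟩
    (toℕ x + (n ∸ toℕ y) + toℕ y) % n  ≡⟨ cong (_% n) (ℕ.+-assoc (toℕ x) _ _) ⟩
    (toℕ x + (n ∸ toℕ y + toℕ y)) % n  ≡⟨ cong ((_% n) ∘ (toℕ x +_)) (ℕ.m∸n+n≡m (toℕ≤n y)) ⟩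
    (toℕ x + n) % n                    ≡⟨ [m+n]%n≡m%n (toℕ x) n ⟩
    toℕ x % n                          ∎)) (mod-toℕ x)
    where open ≡-Reasoning

  [x+y]-y≡x : ∀ x y → (x +ₙ y) -ₙ y ≡ x
  [x+y]-y≡x x y = trans (%≡⇒mod≡ (begin
    (toℕ (x +ₙ y) + (n ∸ toℕ y)) % n    ≡⟨ toℕ-mod-+ˡ _ (n ∸ toℕ y) ⟩
    (toℕ x + toℕ y + (n ∸ toℕ y)) % n   ≡⟨ cong (_% n) (ℕ.+-assoc (toℕ x) _ _) ⟩
    (toℕ x + (toℕ y + (n ∸ toℕ y))) % n ≡⟨ cong ((_% n) ∘ (toℕ x +_)) (ℕ.m+[n∸m]≡n (toℕ≤n y)) ⟩
    (toℕ x + n) % n                     ≡⟨ [m+n]%n≡m%n (toℕ x) n ⟩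
    toℕ x % n                           ∎)) (mod-toℕ x)
    where open ≡-Reasoning

  +ₙ-cancelʳ : ∀ {x y} z → x +ₙ z ≡ y +ₙ z → x ≡ y
  +ₙ-cancelʳ {x} {y} z eq = begin
    x               ≡⟨ [x+y]-y≡x x z ⟨
    (x +ₙ z) -ₙ z   ≡⟨ cong (_-ₙ z) eq ⟩
    (y +ₙ z) -ₙ z   ≡⟨ [x+y]-y≡x y z ⟩
    y               ∎
    where open ≡-Reasoning

  x-x≡0 : ∀ x → x -ₙ x ≡ 0ₙ
  x-x≡0 x = trans (cong (_-ₙ x) (sym (+ₙ-identityˡ x))) ([x+y]-y≡x 0ₙ x)

  x-0≡x : ∀ x → x -ₙ 0ₙ ≡ x
  x-0≡x x = trans (cong (_-ₙ 0ₙ) (sym (+ₙ-identityʳ x))) ([x+y]-y≡x x 0ₙ)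

  x+[y-x]≡y : ∀ x y → x +ₙ (y -ₙ x) ≡ y
  x+[y-x]≡y x y = trans (+ₙ-comm x _) ([x-y]+y≡x y x)

  [x+y]-x≡y : ∀ x y → (x +ₙ y) -ₙ x ≡ y
  [x+y]-x≡y x y = trans (cong (_-ₙ x) (+ₙ-comm x y)) ([x+y]-y≡x y x)

  [x-y]+[y-z]≡x-z : ∀ x y z → (x -ₙ y) +ₙ (y -ₙ z) ≡ x -ₙ z
  [x-y]+[y-z]≡x-z x y z = +ₙ-cancelʳ z (begin
    ((x -ₙ y) +ₙ (y -ₙ z)) +ₙ z  ≡⟨ +ₙ-assoc (x -ₙ y) _ z ⟩
    (x -ₙ y) +ₙ ((y -ₙ z) +ₙ z)  ≡⟨ cong ((x -ₙ y) +ₙ_) ([x-y]+y≡x y z) ⟩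
    (x -ₙ y) +ₙ y                ≡⟨ [x-y]+y≡x x y ⟩
    x                            ≡⟨ [x-y]+y≡x x z ⟨
    (x -ₙ z) +ₙ z                ∎)
    where open ≡-Reasoning

  [x-z]-[y-z]≡x-y : ∀ x y z → (x -ₙ z) -ₙ (y -ₙ z) ≡ x -ₙ y
  [x-z]-[y-z]≡x-y x y z = +ₙ-cancelʳ (y -ₙ z)
    (trans ([x-y]+y≡x (x -ₙ z) (y -ₙ z)) (sym ([x-y]+[y-z]≡x-z x y z)))

-- Subgroups, cosets and stabilisers

module _ {n : ℕ} .{{_ : NonZero n}} where

  record IsSubgroup (H : Pred (Fin n) 0ℓ) : Set where
    field
      0∈H      : H 0ₙ
      +-closed : ∀ {a b} → H a → H b → H (a +ₙ b)
      -‿closed : ∀ {a b} → H a → H b → H (a -ₙ b)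

  IsSubgroup-resp-⇔ : ∀ {H K} → (∀ {a} → H a ⇔ K a) → IsSubgroup H → IsSubgroup K
  IsSubgroup-resp-⇔ H⇔K H-isSubgroup = record
    { 0∈H      = to H⇔K 0∈H
    ; +-closed = λ ka kb → to H⇔K (+-closed (from H⇔K ka) (from H⇔K kb))
    ; -‿closed = λ ka kb → to H⇔K (-‿closed (from H⇔K ka) (from H⇔K kb))
    }
    where open IsSubgroup H-isSubgroup

  ≈[]⇔∈ : ∀ {H} → IsSubgroup H → ∀ x y → x ≈[ H ] y ⇔ H (x -ₙ y)
  ≈[]⇔∈ {H} H-isSubgroup x y = mk⇔
    (λ x≈y → to (x≈y x) (subst H (sym (x-x≡0 x)) 0∈H))
    (λ h z → mk⇔ (λ hzx → subst H ([x-y]+[y-z]≡x-z z x y) (+-closed hzx h))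
                 (λ hzy → subst H ([x-z]-[y-z]≡x-y z x y) (-‿closed hzy h)))
    where open IsSubgroup H-isSubgroup

  ∈S₀⇒∈S : ∀ {S d} → d ∈ S₀ S → d ≢ 0ₙ → d ∈ S
  ∈S₀⇒∈S {S} d∈S₀ d≢0 =
    [ id , (λ d∈⁅0⁆ → contradiction (x∈⁅y⁆⇒x≡y 0ₙ d∈⁅0⁆) d≢0) ]
      (x∈p∪q⁻ S ⁅ 0ₙ ⁆ d∈S₀)

  0∈S₀ : ∀ S → 0ₙ ∈ S₀ S
  0∈S₀ S = x∈p∪q⁺ (inj₂ (x∈⁅x⁆ 0ₙ))

  Stab : Subset n → Pred (Fin n) 0ℓ
  Stab T a = ∀ x → x ∈ T ⇔ x +ₙ a ∈ T

  Stab-isSubgroup : ∀ T → IsSubgroup (Stab T)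
  Stab-isSubgroup T = record
    { 0∈H      = λ x → begin
        x ∈ T          ≡⟨ cong (_∈ T) (+ₙ-identityʳ x) ⟨
        x +ₙ 0ₙ ∈ T    ∎
    ; +-closed = λ {a} {b} sa sb x → begin
        x ∈ T                ≈⟨ sa x ⟩
        x +ₙ a ∈ T           ≈⟨ sb (x +ₙ a) ⟩
        (x +ₙ a) +ₙ b ∈ T    ≡⟨ cong (_∈ T) (+ₙ-assoc x a b) ⟩
        x +ₙ (a +ₙ b) ∈ T    ∎
    ; -‿closed = λ {a} {b} sa sb x → begin
        x ∈ T                       ≈⟨ sa x ⟩
        x +ₙ a ∈ T                  ≡⟨ cong (λ c → x +ₙ c ∈ T) ([x-y]+y≡x a b) ⟨
        x +ₙ ((a -ₙ b) +ₙ b) ∈ T    ≡⟨ cong (_∈ T) (+ₙ-assoc x (a -ₙ b) b) ⟨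
        (x +ₙ (a -ₙ b)) +ₙ b ∈ T    ≈⟨ sb (x +ₙ (a -ₙ b)) ⟨
        x +ₙ (a -ₙ b) ∈ T           ∎
    }
    where open import Relation.Binary.Reasoning.Setoid (⇔-setoid 0ℓ)

  Stab? : ∀ T → Decidable (Stab T)
  Stab? T a = all? λ x → (x ∈? T) ⇔-dec (x +ₙ a ∈? T)

  translate-invariant⇔Stab : ∀ {T a} → (∀ x → x ∈ T + a ⇔ x ∈ T) ⇔ Stab T a
  translate-invariant⇔Stab {T} {a} = mk⇔
    (λ T+a=T x → mk⇔
      (λ x∈T → to (T+a=T (x +ₙ a)) (x , x∈T , refl))
      (λ x+a∈T → cancel (from (T+a=T (x +ₙ a)) x+a∈T)))
    (λ stab x → mk⇔
      (λ { (t , t∈T , x≡t+a) → subst (_∈ T) (sym x≡t+a) (to (stab t) t∈T) })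
      (λ x∈T → x -ₙ a
             , from (stab (x -ₙ a)) (subst (_∈ T) (sym ([x-y]+y≡x x a)) x∈T)
             , sym ([x-y]+y≡x x a)))
    where
    cancel : ∀ {x} → (x +ₙ a) ∈ T + a → x ∈ T
    cancel (t , t∈T , x+a≡t+a) = subst (_∈ T) (+ₙ-cancelʳ a (sym x+a≡t+a)) t∈T

  Periods⇔Stab : ∀ S {a} → Periods S a ⇔ Stab (S₀ S) a
  Periods⇔Stab S {a} = mk⇔
    (λ { (inj₁ refl) → IsSubgroup.0∈H (Stab-isSubgroup (S₀ S))
       ; (inj₂ (_ , S₀+a=S₀)) → to translate-invariant⇔Stab S₀+a=S₀ })
    period
    where
    period : Stab (S₀ S) a → Periods S a
    period stab with a Fin.≟ 0ₙ
    ... | yes a≡0 = inj₁ a≡0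
    ... | no  a≢0 = inj₂ (a≢0 , from translate-invariant⇔Stab stab)

module WreathDecomposition
  {n : ℕ} .{{_ : NonZero n}} {H : Pred (Fin n) 0ℓ}
  (H-isSubgroup : IsSubgroup H) (H? : Decidable H)
  (S : Subset n) (0∉S : 0ₙ ∉ S)
  (S₀+H⊆S₀ : ∀ {s h} → s ∈ S₀ S → H h → s +ₙ h ∈ S₀ S)
  where

  -- x ≈ y unfolds to a statement about z -ₙ x and z -ₙ y, from which x and y
  -- cannot be inferred; hence the many explicit implicit arguments below.
  infix 4 _≈_
  _≈_ : Rel (Fin n) 0ℓ
  x ≈ y = x ≈[ H ] y

  H∖0 : Pred (Fin n) 0ℓ
  H∖0 d = H d × d ≢ 0ₙ

  ≈-isDecEquivalence : IsDecEquivalence _≈_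
  ≈-isDecEquivalence = record
    { isEquivalence = Setoid.isEquivalence (QuotSetoid H)
    ; _≟_           = λ x y → Dec.map (⇔-sym (≈[]⇔∈ H-isSubgroup x y)) (H? (x -ₙ y))
    }

  module ≈ = IsDecEquivalence ≈-isDecEquivalence
  open CanonicalRepresentative ≈-isDecEquivalence

  ≈⇔∈H : ∀ x y → x ≈ y ⇔ H (x -ₙ y)
  ≈⇔∈H = ≈[]⇔∈ H-isSubgroup

  x+h≈x : ∀ x {h} → H h → x +ₙ h ≈ x
  x+h≈x x {h} h∈H = from (≈⇔∈H (x +ₙ h) x) (subst H (sym ([x+y]-x≡y x h)) h∈H)

  ∈S⇔InQuotConn⊎H∖0 : ∀ d → d ∈ S ⇔ (InQuotConn H S d ⊎ H∖0 d)
  ∈S⇔InQuotConn⊎H∖0 d = mk⇔ split join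
    where
    split : d ∈ S → InQuotConn H S d ⊎ H∖0 d
    split d∈S with H? d
    ... | yes d∈H = inj₂ (d∈H , λ d≡0 → 0∉S (subst (_∈ S) d≡0 d∈S))
    ... | no  d∉H = inj₁ ((d , d∈S , ≈.refl {d}) ,
                          λ d≈0 → d∉H (subst H (x-0≡x d) (to (≈⇔∈H d 0ₙ) d≈0)))

    join : InQuotConn H S d ⊎ H∖0 d → d ∈ S
    join (inj₁ ((s , s∈S , d≈s) , d≉0)) = ∈S₀⇒∈S
      (subst (_∈ S₀ S) (x+[y-x]≡y s d)
        (S₀+H⊆S₀ (x∈p∪q⁺ (inj₁ s∈S)) (to (≈⇔∈H d s) d≈s)))
      (d≉0 ∘ ≈.reflexive {d} {0ₙ})
    join (inj₂ (d∈H , d≢0)) = ∈S₀⇒∈S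
      (subst (_∈ S₀ S) (+ₙ-identityˡ d) (S₀+H⊆S₀ (0∈S₀ S) d∈H))
      d≢0

  offset : Fin n → Σ (Fin n) H
  offset x = x -ₙ repr x , to (≈⇔∈H x (repr x)) (≈.sym {repr x} {x} (repr-≈ x))

  offset-diff : ∀ {x y} → x ≈ y → proj₁ (offset x) -ₙ proj₁ (offset y) ≡ x -ₙ y
  offset-diff {x} {y} x≈y =
    trans (cong (λ r → (x -ₙ r) -ₙ (y -ₙ repr y)) (repr-cong {x} {y} x≈y))
          ([x-z]-[y-z]≡x-y x y (repr y))

  decompose : Inverse (V (Cay S)) (V (QuotCay H S ⊗ SubCay H))
  decompose = record
    { to        = coordinates
    ; from      = assemble
    ; to-cong   = coordinates-cong
    ; from-cong = λ {p} {p′} → assemble-cong {p} {p′}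
    ; inverse   = (λ {p} {x} → inverseˡ {p} {x}) , (λ {x} {p} → inverseʳ {x} {p})
    }
    where
    open Setoid (V (QuotCay H S ⊗ SubCay H)) using () renaming (_≈_ to _≋_)

    coordinates : Fin n → Fin n × Σ (Fin n) H
    coordinates x = x , offset x

    assemble : Fin n × Σ (Fin n) H → Fin n
    assemble (q , h , _) = repr q +ₙ h

    coordinates-cong : ∀ {x y} → x ≡ y → coordinates x ≋ coordinates y
    coordinates-cong {x} refl = ≈.refl {x} , refl

    assemble-cong : ∀ {p p′} → p ≋ p′ → assemble p ≡ assemble p′
    assemble-cong {q , _} {q′ , _} (q≈q′ , h≡h′) =
      cong₂ _+ₙ_ (repr-cong {q} {q′} q≈q′) h≡h′

    coordinates-assemble : ∀ p → coordinates (assemble p) ≋ p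
    coordinates-assemble (q , h , h∈H) =
      r+h≈q , trans (cong ((repr q +ₙ h) -ₙ_) (repr-cong {repr q +ₙ h} {q} r+h≈q))
                    ([x+y]-x≡y (repr q) h)
      where
      r+h≈q : repr q +ₙ h ≈ q
      r+h≈q = ≈.trans {repr q +ₙ h} {repr q} {q} (x+h≈x (repr q) h∈H) (repr-≈ q)

    assemble-coordinates : ∀ x → assemble (coordinates x) ≡ x
    assemble-coordinates x = x+[y-x]≡y (repr x) x

    inverseˡ : ∀ {p x} → x ≡ assemble p → coordinates x ≋ p
    inverseˡ {p} refl = coordinates-assemble p

    inverseʳ : ∀ {x p} → p ≋ coordinates x → assemble p ≡ x
    inverseʳ {x} {p} p≋x =
      trans (assemble-cong {p} {coordinates x} p≋x) (assemble-coordinates x)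

  adjacency : ∀ x y →
    (x -ₙ y ∈ S) ⇔ _~_ (QuotCay H S ⊗ SubCay H) (x , offset x) (y , offset y)
  adjacency x y = ⇔-trans (∈S⇔InQuotConn⊎H∖0 (x -ₙ y)) (⇔-refl ⊎-⇔ same-coset)
    where
    same-coset : H∖0 (x -ₙ y) ⇔ (x ≈ y × H∖0 (proj₁ (offset x) -ₙ proj₁ (offset y)))
    same-coset = mk⇔
      (λ d∈H∖0 → let x≈y = from (≈⇔∈H x y) (proj₁ d∈H∖0)
                 in x≈y , subst H∖0 (sym (offset-diff {x} {y} x≈y)) d∈H∖0)
      (λ (x≈y , e∈H∖0) → subst H∖0 (offset-diff {x} {y} x≈y) e∈H∖0)

  Cay≅QuotCay⊗SubCay : Cay S ≅ (QuotCay H S ⊗ SubCay H)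
  Cay≅QuotCay⊗SubCay = record { bij = decompose ; adj = adjacency }

Periods-isSubgroup : ∀ {n} .{{_ : NonZero n}} (S : Subset n) → IsSubgroup (Periods S)
Periods-isSubgroup S = IsSubgroup-resp-⇔ (⇔-sym (Periods⇔Stab S)) (Stab-isSubgroup (S₀ S))

Periods? : ∀ {n} .{{_ : NonZero n}} (S : Subset n) → Decidable (Periods S)
Periods? S a = Dec.map (⇔-sym (Periods⇔Stab S)) (Stab? (S₀ S) a)

S₀+Periods⊆S₀ : ∀ {n} .{{_ : NonZero n}} (S : Subset n) {s h} →
                s ∈ S₀ S → Periods S h → s +ₙ h ∈ S₀ S
S₀+Periods⊆S₀ S {s} s∈S₀ h-period = to (to (Periods⇔Stab S) h-period s) s∈S₀

lemma2p9 : (n : ℕ) .{{_ : NonZero n}} (S : Subset n) →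
    InverseClosed S → 0ₙ ∉ S → Periodic S →
    Cay S ≅ (QuotCay (Periods S) S ⊗ SubCay (Periods S))
lemma2p9 n S _ 0∉S _ =
  WreathDecomposition.Cay≅QuotCay⊗SubCay
    (Periods-isSubgroup S) (Periods? S) S 0∉S (S₀+Periods⊆S₀ S)
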